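{- Let $n\ge1$. (i) If $q$ is prime, then $\mathrm{DI}(\mathbf{OR\text{ - }EQ}_n^q,q)\le 2^n$. (ii) If $q$ is a product of $k\ge1$ pairwise distinct primes, then $\mathrm{DI}(\mathbf{OR\text{ - }EQ}_n^q,q)\ge 2^n/k$.
   Context: For a predicate $P:\mathcal X\times\mathcal Y\to\{0,1\}$ (finite sets) and integer $q\ge2$, an inner product encoding of $P$ modulo $q$ of length $\ell$ is a pair of maps $x\mapsto \vec x\in\mathbb Z_q^\ell$, $y\mapsto\vec y\in\mathbb Z_q^\ell$ such that for all $x,y$: $P(x,y)=1$ iff $\sum_{i=1}^\ell\vec x_i\vec y_i\equiv0\pmod q$; $\mathrm{DI}(P,q)$ is the minimum such $\ell$. The predicate $\mathbf{OR\text{ - }EQ}_n^q:\mathbb Z_q^n\times\mathbb Z_q^n\to\{0,1\}$ is $\mathbf{OR\text{ - }EQ}_n^q(x,y)=1$ iff $x_i=y_i$ for at least one $i\in[n]$. -}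

module Defs where

open import Data.Nat using (ℕ; zero; suc; _+_; _*_; _≤_)
open import Data.Nat.Divisibility using (_∣_)
open import Data.Nat.Primality using (Prime)
open import Data.Fin using (Fin; toℕ)
open import Data.Vec using (Vec; []; _∷_; lookup)
open import Data.List using (List; length)
open import Data.Nat.ListAction using (product)
open import Data.List.Relation.Unary.All using (All)
open import Data.List.Relation.Unary.AllPairs using (AllPairs)
open import Data.Product using (Σ; ∃-syntax; _×_)
open import Relation.Binary.PropositionalEquality using (_≡_; _≢_)
open import Function.Bundles using (_⇔_)

-- Elements of ℤ_q are represented by Fin q (residues 0, …, q-1).

-- Inner product of two vectors over ℤ_q, computed in ℕ on the representatives
-- (its residue mod q is the inner product in ℤ_q).
dot : ∀ {q ℓ} → Vec (Fin q) ℓ → Vec (Fin q) ℓ → ℕ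
dot []       []       = 0
dot (a ∷ as) (b ∷ bs) = toℕ a * toℕ b + dot as bs

-- An inner product encoding of P : X × Y → {0,1} modulo q of length ℓ
-- (P given as a relation: P x y holds iff P(x,y) = 1).
record IPEncoding {X Y : Set} (P : X → Y → Set) (q ℓ : ℕ) : Set where
  field
    encX  : X → Vec (Fin q) ℓ
    encY  : Y → Vec (Fin q) ℓ
    valid : ∀ x y → P x y ⇔ (q ∣ dot (encX x) (encY y))

DI≤ : {X Y : Set} → (X → Y → Set) → ℕ → ℕ → Set
DI≤ P q m = ∃[ ℓ ] (ℓ ≤ m × IPEncoding P q ℓ)

-- DI(P,q) ≥ m (m given as a rational bound a/k, stated as a ≤ k·ℓ) :
-- every encoding of length ℓ satisfies a ≤ k * ℓ
DI≥frac : {X Y : Set} → (X → Y → Set) → ℕ → (a k : ℕ) → Set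
DI≥frac P q a k = ∀ ℓ → IPEncoding P q ℓ → a ≤ k * ℓ

OR-EQ : (n q : ℕ) → Vec (Fin q) n → Vec (Fin q) n → Set
OR-EQ n q x y = ∃[ i ] (lookup x i ≡ lookup y i)

ProductOfDistinctPrimes : ℕ → ℕ → Set
ProductOfDistinctPrimes q k =
  ∃[ ps ] (length ps ≡ k × All Prime ps × AllPairs _≢_ ps × product ps ≡ q)

-- Upper bound: encoding x by the tensor product ⊗ᵢ (xᵢ, 1) and y by ⊗ᵢ (1, −yᵢ) makes the
-- inner product ∏ᵢ (xᵢ − yᵢ), which for prime q vanishes exactly when some xᵢ = yᵢ.
--
-- Lower bound: for a ∈ {0,1}ⁿ let xₐ = a and yₐ = ¬a (over two distinct residues), so that
-- OR-EQ(xₐ, y_b) holds iff a ≠ b. Given an encoding of length ℓ and a prime p ∣ q, the a with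
-- ⟨xₐ, yₐ⟩ ≢ 0 (mod p) have a diagonal, invertible Gram matrix over 𝔽ₚ, so there are at most ℓ
-- of them. Since q is squarefree, every a is of this kind for some prime p ∣ q, so 2ⁿ ≤ kℓ.

module Submission where

open import Defs
open import Data.Bool as Bool using (Bool; true; false; not)
open import Data.Bool.Properties using (¬-not; not-¬)
open import Data.Empty using (⊥-elim)
open import Data.Fin using (Fin; zero; suc; toℕ; punchIn)
open import Data.Fin.Properties using (any?; ⊎⇔∃; punchIn-injective; punchInᵢ≢i; toℕ-injective; toℕ<n; toℕ-fromℕ<)
open import Data.List as List using (List; []; _∷_; length; filter)
open import Data.List.Properties using (length-++; length-map)
open import Data.List.Membership.Propositional.Properties using (∈-lookup)
open import Data.List.Relation.Unary.All as All using (All; []; _∷_)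
open import Data.List.Relation.Unary.All.Properties as All using (all-filter)
open import Data.List.Relation.Unary.AllPairs as AllPairs using (AllPairs; []; _∷_)
import Data.List.Relation.Unary.AllPairs.Properties as AllPairs
open import Data.Nat using (ℕ; zero; suc; pred; nonTrivial⇒n>1; _+_; _*_; _∸_; _^_; _%_; _≤_; _<_; z≤n; s≤s; NonZero)
open import Data.Nat.Divisibility
  using (_∣_; _∤_; divides; _∣?_; _∣0; 1∣_; ∣1⇒≡1; ∣-trans; ∣-reflexive; m∣m*n; ∣m⇒∣m*n; ∣n⇒∣m*n;
         ∣m∣n⇒∣m+n; ∣m+n∣m⇒∣n; m%n≡0⇔n∣m)
open import Data.Nat.DivMod using (_mod_; m%n<n; %-distribˡ-+; %-distribˡ-*; [m+n]%n≡m%n; [m+kn]%n≡m%n; m<n⇒m%n≡m)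
open import Data.Nat.ListAction using (product)
open import Data.Nat.ListAction.Properties using (∈⇒∣product)
open import Data.Nat.Primality using (Prime; euclidsLemma; prime⇒irreducible; prime⇒nonZero; prime⇒nonTrivial; ¬prime[1]; productOfPrimes≥1)
open import Data.Nat.Properties
  using (+-comm; +-assoc; +-suc; +-identityʳ; *-assoc; *-zeroʳ; *-distribʳ-+; suc-pred; ≤-refl; <⇒≤;
         +-mono-≤; *-mono-≤; m≤n⇒m≤1+n; m∸n+n≡m; m+[n∸m]≡n; module ≤-Reasoning)
open import Data.Nat.Tactic.RingSolver using (solve-∀)
open import Data.Product using (∃; _×_; _,_)
open import Data.Sum using (_⊎_; inj₁; inj₂; [_,_])
open import Data.Sum.Function.Propositional using (_⊎-cong_)
open import Data.Vec using (Vec; []; _∷_; head; tail; map; zipWith; _++_; lookup)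
open import Data.Vec.Properties using (lookup-map; ∷-injectiveʳ)
open import Function using (_∘_; _⇔_; mk⇔; Equivalence; Injective)
import Function.Properties.Equivalence as ⇔
import Function.Related.Propositional as Related
open import Relation.Binary.PropositionalEquality using (_≡_; _≢_; refl; sym; trans; cong; cong₂; subst; module ≡-Reasoning)
open import Relation.Binary.Definitions using (DecidableEquality)
open import Relation.Nullary using (¬_; yes; no; ¬?)
open import Relation.Nullary.Decidable using (decidable-stable)
open import Relation.Unary using (Decidable)
open import Relation.Unary.Properties using (∁?)

∣m+n⇔∣m : ∀ {d m n} → d ∣ n → d ∣ m + n ⇔ d ∣ m
∣m+n⇔∣m {d} {m} {n} d∣n =
  mk⇔ (λ d∣m+n → ∣m+n∣m⇒∣n (subst (d ∣_) (+-comm m n) d∣m+n) d∣n) (λ d∣m → ∣m∣n⇒∣m+n d∣m d∣n)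

prime∣m*n⇔∣n : ∀ {p m n} → Prime p → p ∤ m → p ∣ m * n ⇔ p ∣ n
prime∣m*n⇔∣n {p} {m} {n} pr p∤m = mk⇔ to (∣n⇒∣m*n m)
  where
  to : p ∣ m * n → p ∣ n
  to p∣mn with euclidsLemma m n pr p∣mn
  ... | inj₁ p∣m = ⊥-elim (p∤m p∣m)
  ... | inj₂ p∣n = p∣n

prime∣m*n⇔∣m⊎∣n : ∀ {p m n} → Prime p → p ∣ m * n ⇔ (p ∣ m ⊎ p ∣ n)
prime∣m*n⇔∣m⊎∣n {m = m} {n} pr = mk⇔ (euclidsLemma m n pr) [ ∣m⇒∣m*n n , ∣n⇒∣m*n m ]

prime∤product : ∀ {p ps} → Prime p → All Prime ps → All (p ≢_) ps → p ∤ product ps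
prime∤product pr []          []            p∣1 = ¬prime[1] (subst Prime (∣1⇒≡1 p∣1) pr)
prime∤product pr (pr′ ∷ prs) (p≢p′ ∷ p∉ps) p∣Π with euclidsLemma _ _ pr p∣Π
... | inj₂ p∣Πps = prime∤product pr prs p∉ps p∣Πps
... | inj₁ p∣p′ with prime⇒irreducible pr′ p∣p′
...   | inj₁ p≡1  = ¬prime[1] (subst Prime p≡1 pr)
...   | inj₂ p≡p′ = p≢p′ p≡p′

product∣⇔All∣ : ∀ {ps d} → All Prime ps → AllPairs _≢_ ps → product ps ∣ d ⇔ All (_∣ d) ps
product∣⇔All∣ {ps} {d} prs distinct =
  mk⇔ (λ Π∣d → All.tabulate (λ p∈ps → ∣-trans (∈⇒∣product p∈ps) Π∣d)) (All∣⇒product∣ prs distinct)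
  where
  All∣⇒product∣ : ∀ {ps} → All Prime ps → AllPairs _≢_ ps → All (_∣ d) ps → product ps ∣ d
  All∣⇒product∣ [] [] [] = 1∣ d
  All∣⇒product∣ {p ∷ ps} (pr ∷ prs) (p∉ps ∷ distinct) (p∣d ∷ ps∣d)
    with All∣⇒product∣ prs distinct ps∣d
  ... | divides c d≡c*Πps with euclidsLemma c (product ps) pr (subst (p ∣_) d≡c*Πps p∣d)
  ...   | inj₂ p∣Πps = ⊥-elim (prime∤product pr prs p∉ps p∣Πps)
  ...   | inj₁ (divides e c≡e*p) = divides e (begin
    d                     ≡⟨ d≡c*Πps ⟩
    c * product ps        ≡⟨ cong (_* product ps) c≡e*p ⟩
    e * p * product ps    ≡⟨ *-assoc e p (product ps) ⟩
    e * (p * product ps)  ∎)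
    where open ≡-Reasoning

∣+∸⇔≡ : ∀ {q a b} .{{_ : NonZero q}} → a < q → b < q → q ∣ a + (q ∸ b) ⇔ a ≡ b
∣+∸⇔≡ {q} {a} {b} a<q b<q = mk⇔ to from
  where
  to : q ∣ a + (q ∸ b) → a ≡ b
  to (divides k a+[q∸b]≡k*q) = begin
    a               ≡⟨ m<n⇒m%n≡m a<q ⟨
    a % q           ≡⟨ [m+n]%n≡m%n a q ⟨
    (a + q) % q     ≡⟨ cong (_% q) a+q≡b+k*q ⟩
    (b + k * q) % q ≡⟨ [m+kn]%n≡m%n b k q ⟩
    b % q           ≡⟨ m<n⇒m%n≡m b<q ⟩
    b               ∎
    where
    open ≡-Reasoning
    a+q≡b+k*q : a + q ≡ b + k * q
    a+q≡b+k*q = begin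
      a + q           ≡⟨ cong (a +_) (m∸n+n≡m (<⇒≤ b<q)) ⟨
      a + (q ∸ b + b) ≡⟨ +-assoc a (q ∸ b) b ⟨
      a + (q ∸ b) + b ≡⟨ cong (_+ b) a+[q∸b]≡k*q ⟩
      k * q + b       ≡⟨ +-comm (k * q) b ⟩
      b + k * q       ∎

  from : a ≡ b → q ∣ a + (q ∸ b)
  from refl = ∣-reflexive (sym (m+[n∸m]≡n (<⇒≤ b<q)))

productOfPrimes≥2 : ∀ {ps} → All Prime ps → 1 ≤ length ps → 2 ≤ product ps
productOfPrimes≥2 (pr ∷ prs) _ = *-mono-≤ (nonTrivial⇒n>1 _ {{prime⇒nonTrivial pr}}) (productOfPrimes≥1 prs)

lookup-injective : ∀ {A : Set} {xs : List A} → AllPairs _≢_ xs →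
  ∀ i j → List.lookup xs i ≡ List.lookup xs j → i ≡ j
lookup-injective (_ ∷ _)        zero    zero    _ = refl
lookup-injective (x∉xs ∷ _)     zero    (suc j) e = ⊥-elim (All.lookup x∉xs (∈-lookup j) e)
lookup-injective (x∉xs ∷ _)     (suc i) zero    e = ⊥-elim (All.lookup x∉xs (∈-lookup i) (sym e))
lookup-injective (_ ∷ distinct) (suc i) (suc j) e = cong suc (lookup-injective distinct i j e)

length-filter∁+length-filter : ∀ {A : Set} {P : A → Set} (P? : Decidable P) xs →
  length (filter (∁? P?) xs) + length (filter P? xs) ≡ length xs
length-filter∁+length-filter P? [] = refl
length-filter∁+length-filter P? (x ∷ xs) with P? x
... | yes _ = trans (+-suc _ _) (cong suc (length-filter∁+length-filter P? xs))
... | no  _ = cong suc (length-filter∁+length-filter P? xs)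

≢⇒lookup≢ : ∀ {A : Set} {n} → DecidableEquality A → (xs ys : Vec A n) → xs ≢ ys →
  ∃ λ i → lookup xs i ≢ lookup ys i
≢⇒lookup≢ _≟_ []       []       []≢[] = ⊥-elim ([]≢[] refl)
≢⇒lookup≢ _≟_ (x ∷ xs) (y ∷ ys) ≢ with x ≟ y
... | no  x≢y  = zero , x≢y
... | yes refl with ≢⇒lookup≢ _≟_ xs ys (≢ ∘ cong (x ∷_))
...   | i , xsᵢ≢ysᵢ = suc i , xsᵢ≢ysᵢ

allBoolVecs : ∀ n → List (Vec Bool n)
allBoolVecs zero    = [] ∷ []
allBoolVecs (suc n) = List.map (true ∷_) (allBoolVecs n) List.++ List.map (false ∷_) (allBoolVecs n)

length-allBoolVecs : ∀ n → length (allBoolVecs n) ≡ 2 ^ n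
length-allBoolVecs zero    = refl
length-allBoolVecs (suc n) = begin
  length (List.map (true ∷_) (allBoolVecs n) List.++ List.map (false ∷_) (allBoolVecs n))
    ≡⟨ length-++ (List.map (true ∷_) (allBoolVecs n)) ⟩
  length (List.map (true ∷_) (allBoolVecs n)) + length (List.map (false ∷_) (allBoolVecs n))
    ≡⟨ cong₂ _+_ (length-map (true ∷_) (allBoolVecs n)) (length-map (false ∷_) (allBoolVecs n)) ⟩
  length (allBoolVecs n) + length (allBoolVecs n)
    ≡⟨ cong (λ m → m + m) (length-allBoolVecs n) ⟩
  2 ^ n + 2 ^ n
    ≡⟨ cong (2 ^ n +_) (+-identityʳ (2 ^ n)) ⟨
  2 ^ suc n ∎
  where open ≡-Reasoning

allBoolVecs-distinct : ∀ n → AllPairs _≢_ (allBoolVecs n)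
allBoolVecs-distinct zero    = [] ∷ []
allBoolVecs-distinct (suc n) =
  AllPairs.++⁺ (consWith true) (consWith false)
    (All.map⁺ (All.universal (λ _ → All.map⁺ (All.universal (λ _ ()) _)) _))
  where
  consWith : ∀ b → AllPairs _≢_ (List.map (b ∷_) (allBoolVecs n))
  consWith b = AllPairs.map⁺ (AllPairs.map (λ a≢a′ → a≢a′ ∘ ∷-injectiveʳ) (allBoolVecs-distinct n))

distinctPair : ∀ {q} → 2 ≤ q → ∃ λ (b₀ : Fin q) → ∃ λ b₁ → b₀ ≢ b₁
distinctPair {suc (suc _)} _           = zero , suc zero , λ ()
distinctPair {suc zero}    (s≤s ())

dotℕ : ∀ {ℓ} → Vec ℕ ℓ → Vec ℕ ℓ → ℕ
dotℕ []       []       = 0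
dotℕ (a ∷ as) (b ∷ bs) = a * b + dotℕ as bs

dot≡dotℕ : ∀ {q ℓ} (xs ys : Vec (Fin q) ℓ) → dot xs ys ≡ dotℕ (map toℕ xs) (map toℕ ys)
dot≡dotℕ []       []       = refl
dot≡dotℕ (x ∷ xs) (y ∷ ys) = cong (toℕ x * toℕ y +_) (dot≡dotℕ xs ys)

linearCombination : ∀ {ℓ} → ℕ → Vec ℕ ℓ → ℕ → Vec ℕ ℓ → Vec ℕ ℓ
linearCombination c xs d ys = zipWith (λ x y → c * x + d * y) xs ys

dotℕ-linearCombination : ∀ {ℓ} c (xs : Vec ℕ ℓ) d ys zs →
  dotℕ (linearCombination c xs d ys) zs ≡ c * dotℕ xs zs + d * dotℕ ys zs
dotℕ-linearCombination c []       d []       []       = sym (cong₂ _+_ (*-zeroʳ c) (*-zeroʳ d))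
dotℕ-linearCombination c (x ∷ xs) d (y ∷ ys) (z ∷ zs)
  rewrite dotℕ-linearCombination c xs d ys zs = distribute c x d y z (dotℕ xs zs) (dotℕ ys zs)
  where
  distribute : ∀ c x d y z s t →
    (c * x + d * y) * z + (c * s + d * t) ≡ c * (x * z + s) + d * (y * z + t)
  distribute = solve-∀

head-linearCombination : ∀ {ℓ} c (xs : Vec ℕ (suc ℓ)) d ys →
  head (linearCombination c xs d ys) ≡ c * head xs + d * head ys
head-linearCombination c (x ∷ xs) d (y ∷ ys) = refl

∣dotℕ⇔∣dotℕ-tail : ∀ {p ℓ} (xs zs : Vec ℕ (suc ℓ)) → p ∣ head xs →
  p ∣ dotℕ xs zs ⇔ p ∣ dotℕ (tail xs) (tail zs)
∣dotℕ⇔∣dotℕ-tail (x ∷ xs) (z ∷ zs) p∣x =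
  mk⇔ (λ p∣dot → ∣m+n∣m⇒∣n p∣dot (∣m⇒∣m*n z p∣x)) (∣m∣n⇒∣m+n (∣m⇒∣m*n z p∣x))

_⊗_ : ∀ {m k} → Vec ℕ m → Vec ℕ k → Vec ℕ (m * k)
[]       ⊗ ys = []
(x ∷ xs) ⊗ ys = map (x *_) ys ++ xs ⊗ ys

dotℕ-++ : ∀ {m k} (xs xs′ : Vec ℕ m) (ys ys′ : Vec ℕ k) →
  dotℕ (xs ++ ys) (xs′ ++ ys′) ≡ dotℕ xs xs′ + dotℕ ys ys′
dotℕ-++ []       []         ys ys′ = refl
dotℕ-++ (x ∷ xs) (x′ ∷ xs′) ys ys′ =
  trans (cong (x * x′ +_) (dotℕ-++ xs xs′ ys ys′)) (sym (+-assoc (x * x′) _ _))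

dotℕ-map-* : ∀ {k} c d (xs ys : Vec ℕ k) → dotℕ (map (c *_) xs) (map (d *_) ys) ≡ c * d * dotℕ xs ys
dotℕ-map-* c d []       []       = sym (*-zeroʳ (c * d))
dotℕ-map-* c d (x ∷ xs) (y ∷ ys) rewrite dotℕ-map-* c d xs ys = distribute c d x y (dotℕ xs ys)
  where
  distribute : ∀ c d x y s → c * x * (d * y) + c * d * s ≡ c * d * (x * y + s)
  distribute = solve-∀

dotℕ-⊗ : ∀ {m k} (xs xs′ : Vec ℕ m) (ys ys′ : Vec ℕ k) →
  dotℕ (xs ⊗ ys) (xs′ ⊗ ys′) ≡ dotℕ xs xs′ * dotℕ ys ys′
dotℕ-⊗ []       []         ys ys′ = refl
dotℕ-⊗ (x ∷ xs) (x′ ∷ xs′) ys ys′ = begin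
  dotℕ (map (x *_) ys ++ xs ⊗ ys) (map (x′ *_) ys′ ++ xs′ ⊗ ys′)
    ≡⟨ dotℕ-++ (map (x *_) ys) (map (x′ *_) ys′) (xs ⊗ ys) (xs′ ⊗ ys′) ⟩
  dotℕ (map (x *_) ys) (map (x′ *_) ys′) + dotℕ (xs ⊗ ys) (xs′ ⊗ ys′)
    ≡⟨ cong₂ _+_ (dotℕ-map-* x x′ ys ys′) (dotℕ-⊗ xs xs′ ys ys′) ⟩
  x * x′ * dotℕ ys ys′ + dotℕ xs xs′ * dotℕ ys ys′
    ≡⟨ *-distribʳ-+ (dotℕ ys ys′) (x * x′) (dotℕ xs xs′) ⟨
  (x * x′ + dotℕ xs xs′) * dotℕ ys ys′ ∎
  where open ≡-Reasoning

module _ {q : ℕ} .{{_ : NonZero q}} where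

  toℕ-mod : ∀ x → toℕ (x mod q) ≡ x % q
  toℕ-mod x = toℕ-fromℕ< (m%n<n x q)

  reduce : ∀ {m} → Vec ℕ m → Vec (Fin q) m
  reduce = map (_mod q)

  dot-reduce%q : ∀ {m} (xs ys : Vec ℕ m) → dot (reduce xs) (reduce ys) % q ≡ dotℕ xs ys % q
  dot-reduce%q []       []       = refl
  dot-reduce%q (x ∷ xs) (y ∷ ys) = begin
    (toℕ (x mod q) * toℕ (y mod q) + dot (reduce xs) (reduce ys)) % q
      ≡⟨ cong₂ (λ s t → (s * t + dot (reduce xs) (reduce ys)) % q) (toℕ-mod x) (toℕ-mod y) ⟩
    ((x % q) * (y % q) + dot (reduce xs) (reduce ys)) % q
      ≡⟨ %-distribˡ-+ ((x % q) * (y % q)) (dot (reduce xs) (reduce ys)) q ⟩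
    ((x % q) * (y % q) % q + dot (reduce xs) (reduce ys) % q) % q
      ≡⟨ cong₂ (λ s t → (s + t) % q) (sym (%-distribˡ-* x y q)) (dot-reduce%q xs ys) ⟩
    (x * y % q + dotℕ xs ys % q) % q
      ≡⟨ %-distribˡ-+ (x * y) (dotℕ xs ys) q ⟨
    (x * y + dotℕ xs ys) % q ∎
    where open ≡-Reasoning

  ∣dot-reduce⇔∣dotℕ : ∀ {m} (xs ys : Vec ℕ m) → q ∣ dot (reduce xs) (reduce ys) ⇔ q ∣ dotℕ xs ys
  ∣dot-reduce⇔∣dotℕ xs ys =
    q ∣ dot (reduce xs) (reduce ys)      ∼⟨ ⇔.sym (m%n≡0⇔n∣m _ q) ⟩
    dot (reduce xs) (reduce ys) % q ≡ 0  ≡⟨ cong (_≡ 0) (dot-reduce%q xs ys) ⟩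
    dotℕ xs ys % q ≡ 0                   ∼⟨ m%n≡0⇔n∣m _ q ⟩
    q ∣ dotℕ xs ys                       ∎
    where open Related.EquationalReasoning

-- Biorthogonal systems modulo primes

record Biorthogonal (p m ℓ : ℕ) : Set where
  field
    u v  : Fin m → Vec ℕ ℓ
    off  : ∀ {a b} → a ≢ b → p ∣ dotℕ (u a) (v b)
    diag : ∀ a → p ∤ dotℕ (u a) (v a)

reindex : ∀ {p m m′ ℓ ℓ′} (B : Biorthogonal p m′ ℓ′) (f : Fin m → Fin m′) → Injective _≡_ _≡_ f →
  (u v : Fin m → Vec ℕ ℓ) →
  (∀ a b → p ∣ dotℕ (u a) (v b) ⇔ p ∣ dotℕ (Biorthogonal.u B (f a)) (Biorthogonal.v B (f b))) →
  Biorthogonal p m ℓ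
reindex B f f-injective u v ∣⇔ = record
  { u    = u
  ; v    = v
  ; off  = λ {a} {b} a≢b → Equivalence.from (∣⇔ a b) (B.off (a≢b ∘ f-injective))
  ; diag = λ a → B.diag (f a) ∘ Equivalence.to (∣⇔ a a)
  }
  where module B = Biorthogonal B

dropFirstCoordinate : ∀ {p m ℓ} (B : Biorthogonal p m (suc ℓ)) →
  (∀ a → p ∣ head (Biorthogonal.u B a)) → Biorthogonal p m ℓ
dropFirstCoordinate B p∣heads =
  reindex B (λ a → a) (λ e → e) (tail ∘ u) (tail ∘ v)
    (λ a b → ⇔.sym (∣dotℕ⇔∣dotℕ-tail (u a) (v b) (p∣heads a)))
  where open Biorthogonal B

-- Gaussian elimination on the first coordinate with pivot u j; pred p plays the role of −1 modulo p.
eliminateFirstCoordinate : ∀ {p m ℓ} → Prime p → (B : Biorthogonal p (suc m) (suc ℓ)) →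
  (j : Fin (suc m)) → p ∤ head (Biorthogonal.u B j) → Biorthogonal p m ℓ
eliminateFirstCoordinate {p} {m} {ℓ} pr B j p∤pivot =
  reindex B (punchIn j) (punchIn-injective j _ _) u′ v′ ∣⇔
  where
  open Biorthogonal B
  instance
    p≢0 : NonZero p
    p≢0 = prime⇒nonZero pr

  pivot : ℕ
  pivot = head (u j)

  multiplier : Fin m → ℕ
  multiplier a = pred p * head (u (punchIn j a))

  w : Fin m → Vec ℕ (suc ℓ)
  w a = linearCombination pivot (u (punchIn j a)) (multiplier a) (u j)

  u′ v′ : Fin m → Vec ℕ ℓ
  u′ a = tail (w a)
  v′ b = tail (v (punchIn j b))

  p∣head-w : ∀ a → p ∣ head (w a)
  p∣head-w a =
    subst (p ∣_) (sym (trans (head-linearCombination pivot (u (punchIn j a)) (multiplier a) (u j))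
                             (cancel (pred p) pivot (head (u (punchIn j a))))))
      (subst (λ t → p ∣ t * (head (u (punchIn j a)) * pivot)) (sym (suc-pred p)) (m∣m*n _))
    where
    cancel : ∀ c x y → x * y + c * y * x ≡ suc c * (y * x)
    cancel = solve-∀

  ∣⇔ : ∀ a b → p ∣ dotℕ (u′ a) (v′ b) ⇔ p ∣ dotℕ (u (punchIn j a)) (v (punchIn j b))
  ∣⇔ a b =
    p ∣ dotℕ (u′ a) (v′ b)
      ∼⟨ ⇔.sym (∣dotℕ⇔∣dotℕ-tail (w a) (v (punchIn j b)) (p∣head-w a)) ⟩
    p ∣ dotℕ (w a) (v (punchIn j b))
      ≡⟨ cong (p ∣_) (dotℕ-linearCombination pivot (u (punchIn j a)) (multiplier a) (u j) (v (punchIn j b))) ⟩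
    p ∣ pivot * dotℕ (u (punchIn j a)) (v (punchIn j b)) + multiplier a * dotℕ (u j) (v (punchIn j b))
      ∼⟨ ∣m+n⇔∣m (∣n⇒∣m*n (multiplier a) (off (punchInᵢ≢i j b ∘ sym))) ⟩
    p ∣ pivot * dotℕ (u (punchIn j a)) (v (punchIn j b))
      ∼⟨ prime∣m*n⇔∣n pr p∤pivot ⟩
    p ∣ dotℕ (u (punchIn j a)) (v (punchIn j b)) ∎
    where open Related.EquationalReasoning

biorthogonal⇒m≤ℓ : ∀ {p m ℓ} → Prime p → Biorthogonal p m ℓ → m ≤ ℓ
biorthogonal⇒m≤ℓ {m = zero} _ _ = z≤n
biorthogonal⇒m≤ℓ {p} {suc m} {zero} _ B =
  ⊥-elim (diag zero (subst (p ∣_) (sym (dotℕ-empty (u zero) (v zero))) (p ∣0)))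
  where
  open Biorthogonal B
  dotℕ-empty : (xs ys : Vec ℕ 0) → dotℕ xs ys ≡ 0
  dotℕ-empty [] [] = refl
biorthogonal⇒m≤ℓ {p} {suc m} {suc ℓ} pr B with any? (λ j → ¬? (p ∣? head (Biorthogonal.u B j)))
... | yes (j , p∤pivot) = s≤s (biorthogonal⇒m≤ℓ pr (eliminateFirstCoordinate pr B j p∤pivot))
... | no noPivot        = m≤n⇒m≤1+n (biorthogonal⇒m≤ℓ pr (dropFirstCoordinate B p∣heads))
  where
  p∣heads : ∀ a → p ∣ head (Biorthogonal.u B a)
  p∣heads a = decidable-stable (p ∣? _) (λ p∤head → noPivot (a , p∤head))

module _ {A : Set} {ℓ : ℕ} (u v : A → Vec ℕ ℓ) where

  distinct-length≤ : ∀ {p xs} → Prime p → AllPairs _≢_ xs →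
    (∀ {a b} → a ≢ b → p ∣ dotℕ (u a) (v b)) → All (λ a → p ∤ dotℕ (u a) (v a)) xs →
    length xs ≤ ℓ
  distinct-length≤ {xs = xs} pr distinct off diag = biorthogonal⇒m≤ℓ pr (record
    { u    = u ∘ List.lookup xs
    ; v    = v ∘ List.lookup xs
    ; off  = λ i≢j → off (i≢j ∘ lookup-injective distinct _ _)
    ; diag = λ i → All.lookup diag (∈-lookup i)
    })

  -- Each a is charged to a prime p of ps with p ∤ u a · v a; the elements charged to one prime
  -- number at most ℓ.
  distinct-length≤length*ℓ : ∀ {ps xs} → All Prime ps → AllPairs _≢_ xs →
    (∀ {a b} → a ≢ b → All (_∣ dotℕ (u a) (v b)) ps) →
    All (λ a → ¬ All (_∣ dotℕ (u a) (v a)) ps) xs →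
    length xs ≤ length ps * ℓ
  distinct-length≤length*ℓ {[]}     {[]}    _ _ _ _ = z≤n
  distinct-length≤length*ℓ {[]}     {_ ∷ _} _ _ _ (¬all ∷ _) = ⊥-elim (¬all [])
  distinct-length≤length*ℓ {p ∷ ps} {xs} (pr ∷ prs) distinct off diag = begin
    length xs                                                    ≡⟨ length-filter∁+length-filter p∣diag? xs ⟨
    length (filter (∁? p∣diag?) xs) + length (filter p∣diag? xs) ≤⟨ +-mono-≤ charged-to-p charged-to-ps ⟩
    ℓ + length ps * ℓ                                            ∎
    where
    open ≤-Reasoning
    p∣diag? : Decidable (λ a → p ∣ dotℕ (u a) (v a))
    p∣diag? a = p ∣? dotℕ (u a) (v a)

    charged-to-p : length (filter (∁? p∣diag?) xs) ≤ ℓ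
    charged-to-p = distinct-length≤ pr (AllPairs.filter⁺ (∁? p∣diag?) distinct)
      (All.head ∘ off) (all-filter (∁? p∣diag?) xs)

    charged-to-ps : length (filter p∣diag? xs) ≤ length ps * ℓ
    charged-to-ps = distinct-length≤length*ℓ prs (AllPairs.filter⁺ p∣diag? distinct)
      (All.tail ∘ off)
      (All.zipWith (λ { (¬all , p∣) all → ¬all (p∣ ∷ all) }) (All.filter⁺ p∣diag? diag , all-filter p∣diag? xs))

foolingSet-length≤ : ∀ {X Y A : Set} {P : X → Y → Set} {q ℓ ps} →
  All Prime ps → AllPairs _≢_ ps → product ps ≡ q → IPEncoding P q ℓ →
  (x : A → X) (y : A → Y) → (∀ {a b} → a ≢ b → P (x a) (y b)) → (∀ a → ¬ P (x a) (y a)) →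
  ∀ {as} → AllPairs _≢_ as → length as ≤ length ps * ℓ
foolingSet-length≤ {X} {Y} {A} {P} {q} {ℓ} {ps} prs distinctPrimes Πps≡q E x y fooling diagonal {as} distinct =
  distinct-length≤length*ℓ u v prs distinct
    (λ a≢b → Equivalence.to (P⇔All∣ _ _) (fooling a≢b))
    (All.universal (λ a → diagonal a ∘ Equivalence.from (P⇔All∣ a a)) as)
  where
  open IPEncoding E
  u v : A → Vec ℕ ℓ
  u a = map toℕ (encX (x a))
  v b = map toℕ (encY (y b))

  P⇔All∣ : ∀ a b → P (x a) (y b) ⇔ All (_∣ dotℕ (u a) (v b)) ps
  P⇔All∣ a b =
    P (x a) (y b)                             ∼⟨ valid (x a) (y b) ⟩
    q ∣ dot (encX (x a)) (encY (y b))          ≡⟨ cong₂ _∣_ (sym Πps≡q) (dot≡dotℕ (encX (x a)) (encY (y b))) ⟩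
    product ps ∣ dotℕ (u a) (v b)             ∼⟨ product∣⇔All∣ prs distinctPrimes ⟩
    All (_∣ dotℕ (u a) (v b)) ps              ∎
    where open Related.EquationalReasoning

module _ (q : ℕ) where

  encodeX encodeY : ∀ {n} → Vec (Fin q) n → Vec ℕ (2 ^ n)
  encodeX []      = 1 ∷ []
  encodeX (a ∷ x) = (toℕ a ∷ 1 ∷ []) ⊗ encodeX x
  encodeY []      = 1 ∷ []
  encodeY (b ∷ y) = (1 ∷ (q ∸ toℕ b) ∷ []) ⊗ encodeY y

  dotℕ-encode∷ : ∀ {n} a b (x y : Vec (Fin q) n) →
    dotℕ (encodeX (a ∷ x)) (encodeY (b ∷ y)) ≡ (toℕ a + (q ∸ toℕ b)) * dotℕ (encodeX x) (encodeY y)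
  dotℕ-encode∷ a b x y =
    trans (dotℕ-⊗ (toℕ a ∷ 1 ∷ []) (1 ∷ (q ∸ toℕ b) ∷ []) (encodeX x) (encodeY y))
          (cong (_* dotℕ (encodeX x) (encodeY y)) (simplify (toℕ a) (q ∸ toℕ b)))
    where
    simplify : ∀ s t → s * 1 + (1 * t + 0) ≡ s + t
    simplify = solve-∀

  prime∣dotℕ-encode⇔OR-EQ : Prime q → ∀ {n} (x y : Vec (Fin q) n) →
    q ∣ dotℕ (encodeX x) (encodeY y) ⇔ OR-EQ n q x y
  prime∣dotℕ-encode⇔OR-EQ pr []      []      =
    mk⇔ (λ q∣1 → ⊥-elim (¬prime[1] (subst Prime (∣1⇒≡1 q∣1) pr))) (λ { (() , _) })
  prime∣dotℕ-encode⇔OR-EQ pr {suc n} (a ∷ x) (b ∷ y) =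
    q ∣ dotℕ (encodeX (a ∷ x)) (encodeY (b ∷ y))
      ≡⟨ cong (q ∣_) (dotℕ-encode∷ a b x y) ⟩
    q ∣ (toℕ a + (q ∸ toℕ b)) * dotℕ (encodeX x) (encodeY y)
      ∼⟨ prime∣m*n⇔∣m⊎∣n pr ⟩
    (q ∣ toℕ a + (q ∸ toℕ b) ⊎ q ∣ dotℕ (encodeX x) (encodeY y))
      ∼⟨ ⇔.trans (∣+∸⇔≡ (toℕ<n a) (toℕ<n b)) (mk⇔ toℕ-injective (cong toℕ))
           ⊎-cong prime∣dotℕ-encode⇔OR-EQ pr x y ⟩
    (a ≡ b ⊎ OR-EQ n q x y)
      ∼⟨ ⊎⇔∃ ⟩
    OR-EQ (suc n) q (a ∷ x) (b ∷ y) ∎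
    where
    open Related.EquationalReasoning
    instance
      q≢0 : NonZero q
      q≢0 = prime⇒nonZero pr

OR-EQ-DI≤ : ∀ n q → Prime q → DI≤ (OR-EQ n q) q (2 ^ n)
OR-EQ-DI≤ n q pr = 2 ^ n , ≤-refl , record
  { encX  = reduce ∘ encodeX q
  ; encY  = reduce ∘ encodeY q
  ; valid = λ x y → ⇔.sym (⇔.trans (∣dot-reduce⇔∣dotℕ (encodeX q x) (encodeY q y))
                                   (prime∣dotℕ-encode⇔OR-EQ q pr x y))
  }
  where
  instance
    q≢0 : NonZero q
    q≢0 = prime⇒nonZero pr

module _ {q} {b₀ b₁ : Fin q} (b₀≢b₁ : b₀ ≢ b₁) where

  bit : Bool → Fin q
  bit false = b₀
  bit true  = b₁

  bit-injective : ∀ {x y} → bit x ≡ bit y → x ≡ y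
  bit-injective {false} {false} _ = refl
  bit-injective {false} {true}  e = ⊥-elim (b₀≢b₁ e)
  bit-injective {true}  {false} e = ⊥-elim (b₀≢b₁ (sym e))
  bit-injective {true}  {true}  _ = refl

  OR-EQ⇔≢ : ∀ {n} (a b : Vec Bool n) → OR-EQ n q (map bit a) (map (bit ∘ not) b) ⇔ a ≢ b
  OR-EQ⇔≢ {n} a b = mk⇔ to from
    where
    agree⇔ : ∀ i → lookup (map bit a) i ≡ lookup (map (bit ∘ not) b) i ⇔ lookup a i ≡ not (lookup b i)
    agree⇔ i rewrite lookup-map i bit a | lookup-map i (bit ∘ not) b = mk⇔ bit-injective (cong bit)

    to : OR-EQ n q (map bit a) (map (bit ∘ not) b) → a ≢ b
    to (i , agree) refl = not-¬ refl (Equivalence.to (agree⇔ i) agree)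

    from : a ≢ b → OR-EQ n q (map bit a) (map (bit ∘ not) b)
    from a≢b with ≢⇒lookup≢ Bool._≟_ a b a≢b
    ... | i , aᵢ≢bᵢ = i , Equivalence.from (agree⇔ i) (¬-not aᵢ≢bᵢ)

OR-EQ-DI≥ : ∀ n q k → 1 ≤ k → ProductOfDistinctPrimes q k → DI≥frac (OR-EQ n q) q (2 ^ n) k
OR-EQ-DI≥ n q k 1≤k (ps , refl , prs , distinctPrimes , Πps≡q) ℓ E
  with b₀ , b₁ , b₀≢b₁ ← distinctPair (subst (2 ≤_) Πps≡q (productOfPrimes≥2 prs 1≤k)) =
  subst (_≤ length ps * ℓ) (length-allBoolVecs n)
    (foolingSet-length≤ prs distinctPrimes Πps≡q E (map (bit b₀≢b₁)) (map (bit b₀≢b₁ ∘ not))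
      (Equivalence.from (OR-EQ⇔≢ b₀≢b₁ _ _))
      (λ a agree → Equivalence.to (OR-EQ⇔≢ b₀≢b₁ a a) agree refl)
      (allBoolVecs-distinct n))

mainTheorem11 : ∀ (n : ℕ) → 1 ≤ n →
    ((q : ℕ) → Prime q → DI≤ (OR-EQ n q) q (2 ^ n))
    × ((q k : ℕ) → 1 ≤ k → ProductOfDistinctPrimes q k →
        DI≥frac (OR-EQ n q) q (2 ^ n) k)
mainTheorem11 n _ = OR-EQ-DI≤ n , OR-EQ-DI≥ n
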